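{- Let $r,n$ be integers with $2r-1\le n<r^2$, and let $H$ be an $n$-vertex $r$-uniform hypergraph with cover number at least $r$. Then \[ |E(H)|>\frac{n}{5r}\cdot\frac{\binom{n}{r-1}}{\binom{n-r}{r-1}}, \] and moreover there exist absolute constants $c,c'>0$ (independent of $n,r,H$) such that $\frac{n}{5r}\cdot\frac{\binom{n}{r-1}}{\binom{n-r}{r-1}}\ge c'\,\frac{n}{r}\, e^{c\, r^2/n}$.
   Context: The cover number of a hypergraph is the minimum size of a set of vertices meeting every edge. A hypergraph is $r$-uniform if every edge has exactly $r$ vertices. -}

module Defs where

open import Data.Nat using (ℕ; zero; suc; _≤_)
open import Data.Integer using (+_)
open import Data.Rational using (ℚ; 0ℚ; 1ℚ; _/_; _*_)
open import Data.List using (List)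
open import Data.List.Relation.Unary.All using (All)
open import Data.List.Relation.Unary.Unique.Propositional using (Unique)
open import Data.Fin.Subset using (Subset; Nonempty; _∩_; ∣_∣)
open import Relation.Binary.PropositionalEquality using (_≡_)

record UniformHypergraph (n r : ℕ) : Set where
  field
    edges   : List (Subset n)
    unique  : Unique edges
    uniform : All (λ e → ∣ e ∣ ≡ r) edges

open UniformHypergraph public

numEdges : ∀ {n r} → UniformHypergraph n r → ℕ
numEdges H = Data.List.length (edges H)

IsCover : ∀ {n r} → UniformHypergraph n r → Subset n → Set
IsCover H C = All (λ e → Nonempty (C ∩ e)) (edges H)

CoverNumberAtLeast : ∀ {n r} → UniformHypergraph n r → ℕ → Set
CoverNumberAtLeast H k = ∀ C → IsCover H C → k ≤ ∣ C ∣

-- a / b as a rational number (only used with b ≠ 0; set to 0 when b = 0)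
ratio : ℕ → ℕ → ℚ
ratio a zero    = 0ℚ
ratio a (suc b) = (+ a) / suc b

_^ℚ_ : ℚ → ℕ → ℚ
q ^ℚ zero  = 1ℚ
q ^ℚ suc k = q * (q ^ℚ k)

{-# OPTIONS --safe #-}
module Submission where

open import Defs
open import Data.Nat
open import Data.Nat.Properties
open import Data.Nat.Combinatorics using (_C_; nCk+nC[k+1]≡[n+1]C[k+1])
open import Data.Nat.DivMod using (m≡m%n+[m/n]*n; m%n<n)
open import Data.Nat.Tactic.RingSolver using (solve-∀)
open import Data.Fin using (Fin; zero; suc; punchIn)
open import Data.Fin.Subset using (Subset; Side; inside; outside; Nonempty; _∩_; _∈_; ∣_∣) renaming (⊥ to ∅)
open import Data.Fin.Subset.Properties using (x∈p∩q⁺; x∈p∩q⁻; ∣⊥∣≡0)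
open import Data.Vec using (_∷_; []; here; there; lookup; insertAt; removeAt)
open import Data.Vec.Properties using (lookup⇒[]=; []=⇒lookup; insertAt-lookup; insertAt-punchIn; insertAt-removeAt; removeAt-insertAt)
open import Data.List using (List; []; _∷_; length)
open import Data.List.Relation.Unary.All using (All; []; _∷_)
open import Data.Product using (Σ; ∃; _×_; _,_)
open import Data.Integer as ℤ using (+≤+; +<+)
import Data.Integer.Properties as ℤₚ
open import Data.Rational using (ℚ; 0ℚ; 1ℚ; toℚᵘ) renaming (_*_ to _*ℚ_; _<_ to _<ℚ_; _≤_ to _≤ℚ_)
open import Data.Rational.Properties using (toℚᵘ-fromℚᵘ; toℚᵘ-homo-*; toℚᵘ-cancel-≤; toℚᵘ-cancel-<)
open import Data.Rational.Unnormalised using (mkℚᵘ; *≤*; *<*) renaming (_≃_ to _≃ᵘ_; _/_ to _/ᵘ_)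
open import Data.Rational.Unnormalised.Properties using (≃-refl; ≃-sym; ≃-trans; ≃-reflexive; *-cong; ≤-respˡ-≃; ≤-respʳ-≃; <-respˡ-≃; <-respʳ-≃)
open import Relation.Binary.PropositionalEquality
open import Relation.Nullary using (yes; no; contradiction)
open import Algebra.Properties.CommutativeSemigroup +-commutativeSemigroup using ()
  renaming (x∙yz≈y∙xz to x+[y+z]≡y+[x+z])
open import Algebra.Properties.CommutativeSemigroup *-commutativeSemigroup using ()
  renaming (interchange to *-interchange; x∙yz≈y∙xz to x*[y*z]≡y*[x*z]; x∙yz≈yx∙z to x*[y*z]≡y*x*z;
            xy∙z≈y∙xz to x*y*z≡y*[x*z]; xy∙z≈xz∙y to x*y*z≡x*z*y)
open import Algebra.Properties.CommutativeMonoid.Sum +-0-commutativeMonoid using (sum; ∑-distrib-+; sum-replicate-zero)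

-- Write m for the number of edges, τ for the cover number and x↓j for the falling factorial.
-- A vertex of maximum degree lies in at least m r / n edges; deleting it together with these
-- edges leaves an r-uniform hypergraph on n − 1 vertices with at most m (n − r) / n edges and
-- cover number at least τ − 1. Iterating gives (τ − j) n↓j ≤ m (n − r)↓j for every j < τ
-- (for j = 0 this says τ ≤ m). For τ = r and n = 2r − 2 + x one takes j = r − 1 − s with
-- s = ⌊x / 2r⌋; the remaining s factors of n↓(r−1) / (n − r)↓(r−1) form a quotient of rising
-- factorials which is small enough to give m > n/(5r) · C(n, r−1) / C(n − r, r−1).
--
-- For the second claim, raised to the n-th power, C(n − r, r−1) / C(n, r−1) ≤ (1 − r/n)^(r−1),
-- (1 − r/n)^n ≤ (2/3)^r, and (2/3)^(r(r−1)) ≤ (5/6)^(r²) for r ≥ 2; so b = 6/5 and c′ = 1/5 work.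

-- Falling and rising factorials

falling : ℕ → ℕ → ℕ
falling x zero    = 1
falling x (suc k) = x * falling (pred x) k

rising : ℕ → ℕ → ℕ
rising y zero    = 1
rising y (suc s) = rising y s * (y + s)

falling-suc : ∀ x k → falling x (suc k) + k * falling x k ≡ x * falling x k
falling-suc zero    zero    = refl
falling-suc zero    (suc k) = *-zeroʳ k
falling-suc (suc x) zero    = +-identityʳ _
falling-suc (suc x) (suc k) = begin
  suc x * falling x (suc k) + suc k * (suc x * falling x k)          ≡⟨ regroup (suc x) (falling x (suc k)) (falling x k) k ⟩
  suc x * (falling x (suc k) + k * falling x k) + suc x * falling x k ≡⟨ cong (λ y → suc x * y + suc x * falling x k) (falling-suc x k) ⟩
  suc x * (x * falling x k) + suc x * falling x k                    ≡⟨ trans (*-distribˡ-+ (suc x) (falling x k) (x * falling x k)) (+-comm (suc x * falling x k) _) ⟨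
  suc x * (suc x * falling x k)                                      ∎
  where
  open ≡-Reasoning
  regroup : ∀ a b c k → a * b + suc k * (a * c) ≡ a * (b + k * c) + a * c
  regroup = solve-∀

C*!≡falling : ∀ n k → (n C k) * k ! ≡ falling n k
C*!≡falling n       zero    = refl
C*!≡falling zero    (suc k) = refl
C*!≡falling (suc n) (suc k) = begin
  (suc n C suc k) * (suc k * k !)                          ≡⟨ cong (_* (suc k * k !)) (nCk+nC[k+1]≡[n+1]C[k+1] n k) ⟨
  ((n C k) + (n C suc k)) * (suc k * k !)                  ≡⟨ regroup₁ (n C k) (n C suc k) k (k !) ⟩
  suc k * ((n C k) * k !) + (n C suc k) * (suc k * k !)    ≡⟨ cong₂ (λ a b → suc k * a + b) (C*!≡falling n k) (C*!≡falling n (suc k)) ⟩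
  suc k * falling n k + falling n (suc k)                  ≡⟨ regroup₂ k (falling n k) (falling n (suc k)) ⟩
  falling n k + (falling n (suc k) + k * falling n k)      ≡⟨ cong (falling n k +_) (falling-suc n k) ⟩
  falling n k + n * falling n k                            ∎
  where
  open ≡-Reasoning
  regroup₁ : ∀ a b k f → (a + b) * (suc k * f) ≡ suc k * (a * f) + b * (suc k * f)
  regroup₁ = solve-∀
  regroup₂ : ∀ k f g → suc k * f + g ≡ f + (g + k * f)
  regroup₂ = solve-∀

falling-+ : ∀ x a b → falling x (a + b) ≡ falling x a * falling (x ∸ a) b
falling-+ x       zero    b = sym (+-identityʳ _)
falling-+ zero    (suc a) b = refl
falling-+ (suc x) (suc a) b = trans (cong (suc x *_) (falling-+ x a b)) (sym (*-assoc (suc x) (falling x a) (falling (x ∸ a) b)))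

falling>0 : ∀ {x k} → k ≤ x → 0 < falling x k
falling>0 {k = zero}      _         = z<s
falling>0 {suc x} {suc k} (s≤s k≤x) = *-mono-< {0} {suc x} z<s (falling>0 k≤x)

C>0 : ∀ {n k} → k ≤ n → 0 < n C k
C>0 {n} {k} k≤n = *-cancelʳ-< (k !) 0 (n C k) (subst (0 <_) (sym (C*!≡falling n k)) (falling>0 k≤n))

falling≡rising : ∀ y s → falling (y + s) s ≡ rising (suc y) s
falling≡rising y zero    = refl
falling≡rising y (suc s) = begin
  (y + suc s) * falling (pred (y + suc s)) s  ≡⟨ cong (λ z → z * falling (pred z) s) (+-suc y s) ⟩
  suc (y + s) * falling (y + s) s             ≡⟨ cong (suc (y + s) *_) (falling≡rising y s) ⟩
  suc (y + s) * rising (suc y) s              ≡⟨ *-comm (suc (y + s)) _ ⟩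
  rising (suc y) s * suc (y + s)              ∎
  where open ≡-Reasoning

rising>0 : ∀ {x} s → 0 < x → 0 < rising x s
rising>0     zero    _   = z<s
rising>0 {x} (suc s) x>0 = *-mono-< {0} {rising x s} {0} {x + s} (rising>0 s x>0) (≤-trans x>0 (m≤m+n x s))

shift-step : ∀ {X y} s r → X ≤ y → (y + r + s) * (X ∸ r) ≤ (y + s) * X
shift-step {X} {y} s r X≤y with X ≤? r
... | yes X≤r = ≤-trans (≤-reflexive (trans (cong ((y + r + s) *_) (m≤n⇒m∸n≡0 X≤r)) (*-zeroʳ (y + r + s)))) z≤n
... | no  X≰r = begin
  (y + r + s) * (X ∸ r)             ≡⟨ regroup₁ y r s (X ∸ r) ⟩
  (y + s) * (X ∸ r) + r * (X ∸ r)   ≤⟨ +-monoʳ-≤ ((y + s) * (X ∸ r)) (*-monoʳ-≤ r (≤-trans (m∸n≤m X r) (≤-trans X≤y (m≤m+n y s)))) ⟩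
  (y + s) * (X ∸ r) + r * (y + s)   ≡⟨ regroup₂ (y + s) (X ∸ r) r ⟩
  (y + s) * (r + (X ∸ r))           ≡⟨ cong ((y + s) *_) (m+[n∸m]≡n (<⇒≤ (≰⇒> X≰r))) ⟩
  (y + s) * X                       ∎
  where
  open ≤-Reasoning
  regroup₁ : ∀ y r s w → (y + r + s) * w ≡ (y + s) * w + r * w
  regroup₁ = solve-∀
  regroup₂ : ∀ a w r → a * w + r * a ≡ a * (r + w)
  regroup₂ = solve-∀

rising-shift : ∀ s {x y} r → x ≤ y → rising (y + r) s * (x ∸ s * r) ≤ rising y s * x
rising-shift zero    r x≤y = ≤-refl
rising-shift (suc s) {x} {y} r x≤y = begin
  rising (y + r) s * (y + r + s) * (x ∸ (r + s * r))   ≡⟨ *-assoc (rising (y + r) s) _ _ ⟩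
  rising (y + r) s * ((y + r + s) * (x ∸ (r + s * r))) ≡⟨ cong (λ z → rising (y + r) s * ((y + r + s) * z)) x∸[1+s]r ⟩
  rising (y + r) s * ((y + r + s) * (X ∸ r))           ≤⟨ *-monoʳ-≤ (rising (y + r) s) (shift-step s r (≤-trans (m∸n≤m x (s * r)) x≤y)) ⟩
  rising (y + r) s * ((y + s) * X)                     ≡⟨ x*[y*z]≡y*[x*z] (rising (y + r) s) (y + s) X ⟩
  (y + s) * (rising (y + r) s * X)                     ≤⟨ *-monoʳ-≤ (y + s) (rising-shift s r x≤y) ⟩
  (y + s) * (rising y s * x)                           ≡⟨ x*[y*z]≡y*x*z (y + s) (rising y s) x ⟩
  rising y s * (y + s) * x                             ∎
  where
  open ≤-Reasoning
  X = x ∸ s * r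
  x∸[1+s]r : x ∸ (r + s * r) ≡ X ∸ r
  x∸[1+s]r = trans (cong (x ∸_) (+-comm r (s * r))) (sym (∸-+-assoc x (s * r) r))

pred-ratio-≤ : ∀ {y r p q} → p ≤ q → (y ∸ r) * q ≤ y * p → (pred y ∸ r) * q ≤ pred y * p
pred-ratio-≤ {zero} {r} {q = q} _ _ = ≤-trans (≤-reflexive (cong (_* q) (0∸n≡0 r))) z≤n
pred-ratio-≤ {suc y} {r} {p} {q} p≤q ratio≤ with r ≤? y
... | no  r≰y = ≤-trans (≤-reflexive (cong (_* q) (m≤n⇒m∸n≡0 (<⇒≤ (≰⇒> r≰y))))) z≤n
... | yes r≤y = +-cancelʳ-≤ q _ _ (begin
  (y ∸ r) * q + q     ≡⟨ +-comm _ q ⟩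
  suc (y ∸ r) * q     ≡⟨ cong (_* q) (+-∸-assoc 1 r≤y) ⟨
  (suc y ∸ r) * q     ≤⟨ ratio≤ ⟩
  suc y * p           ≡⟨ +-comm p (y * p) ⟩
  y * p + p           ≤⟨ +-monoʳ-≤ (y * p) p≤q ⟩
  y * p + q           ∎)
  where open ≤-Reasoning

falling-ratio-≤ : ∀ {y r p q} k → p ≤ q → (y ∸ r) * q ≤ y * p → falling (y ∸ r) k * q ^ k ≤ falling y k * p ^ k
falling-ratio-≤ zero p≤q ratio≤ = ≤-refl
falling-ratio-≤ {zero} {r} {q = q} (suc k) _ _ = subst (λ z → falling z (suc k) * q ^ suc k ≤ 0) (sym (0∸n≡0 r)) z≤n
falling-ratio-≤ {suc y} {r} {p} {q} (suc k) p≤q ratio≤ = begin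
  (suc y ∸ r) * falling (pred (suc y ∸ r)) k * (q * q ^ k)  ≡⟨ *-interchange (suc y ∸ r) (falling (pred (suc y ∸ r)) k) q (q ^ k) ⟩
  (suc y ∸ r) * q * (falling (pred (suc y ∸ r)) k * q ^ k)  ≤⟨ *-mono-≤ ratio≤ (subst (λ z → falling z k * q ^ k ≤ falling y k * p ^ k) (sym (pred[m∸n]≡m∸[1+n] (suc y) r)) IH) ⟩
  suc y * p * (falling y k * p ^ k)                         ≡⟨ *-interchange (suc y) (falling y k) p (p ^ k) ⟨
  suc y * falling y k * (p * p ^ k)                         ∎
  where
  open ≤-Reasoning
  IH : falling (y ∸ r) k * q ^ k ≤ falling y k * p ^ k
  IH = falling-ratio-≤ {y} {r} k p≤q (pred-ratio-≤ {suc y} {r} p≤q ratio≤)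

-- Power estimates

^-distribʳ-* : ∀ a b k → (a * b) ^ k ≡ a ^ k * b ^ k
^-distribʳ-* a b zero    = refl
^-distribʳ-* a b (suc k) = trans (cong ((a * b) *_) (^-distribʳ-* a b k)) (*-interchange a b (a ^ k) (b ^ k))

^-mono-*-≤ : ∀ {a b c d} k → a * b ≤ c * d → a ^ k * b ^ k ≤ c ^ k * d ^ k
^-mono-*-≤ {a} {b} {c} {d} k ab≤cd = subst₂ _≤_ (^-distribʳ-* a b k) (^-distribʳ-* c d k) (^-monoˡ-≤ k ab≤cd)

^-comm : ∀ x a b → (x ^ a) ^ b ≡ (x ^ b) ^ a
^-comm x a b = trans (^-*-assoc x a b) (trans (cong (x ^_) (*-comm a b)) (sym (^-*-assoc x b a)))

bernoulli-reciprocal : ∀ r w q → w ^ q * (r + w + q * r) ≤ (r + w) ^ q * (r + w)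
bernoulli-reciprocal r w zero    = ≤-reflexive (cong (1 *_) (+-identityʳ (r + w)))
bernoulli-reciprocal r w (suc q) = begin
  w * w ^ q * (n + (r + q * r))    ≡⟨ x*y*z≡y*[x*z] w (w ^ q) (n + (r + q * r)) ⟩
  w ^ q * (w * (n + (r + q * r)))  ≤⟨ *-monoʳ-≤ (w ^ q) step ⟩
  w ^ q * ((n + q * r) * n)        ≡⟨ *-assoc (w ^ q) _ n ⟨
  w ^ q * (n + q * r) * n          ≤⟨ *-monoˡ-≤ n (bernoulli-reciprocal r w q) ⟩
  n ^ q * n * n                    ≡⟨ cong (_* n) (*-comm (n ^ q) n) ⟩
  n * n ^ q * n                    ∎
  where
  open ≤-Reasoning
  n = r + w
  identity : ∀ r w q → (r + w + q * r) * (r + w) ≡ w * (r + w + (r + q * r)) + (r * r + q * r * r)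
  identity = solve-∀
  step : w * (n + (r + q * r)) ≤ (n + q * r) * n
  step = subst (w * (n + (r + q * r)) ≤_) (sym (identity r w q)) (m≤m+n _ _)

-- Split n = ρ + q r with ρ < r; since q ≥ 1 we have n ≤ 2 q r, and bernoulli-reciprocal gives
-- (w / n)^q ≤ n / (n + q r) ≤ 2/3.
[1-r/n]^n≤[2/3]^r : ∀ r w → 0 < r → 3 ^ r * w ^ (r + w) ≤ 2 ^ r * (r + w) ^ (r + w)
[1-r/n]^n≤[2/3]^r r@(suc _) w _ = begin
  3 ^ r * w ^ n                     ≡⟨ cong (3 ^ r *_) (w^n≡ w) ⟩
  3 ^ r * (w ^ ρ * (w ^ q) ^ r)     ≡⟨ x*[y*z]≡y*[x*z] (3 ^ r) (w ^ ρ) ((w ^ q) ^ r) ⟩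
  w ^ ρ * (3 ^ r * (w ^ q) ^ r)     ≤⟨ *-mono-≤ (^-monoˡ-≤ ρ (m≤n+m w r)) (^-mono-*-≤ {3} {w ^ q} {2} {n ^ q} r 3w^q≤2n^q) ⟩
  n ^ ρ * (2 ^ r * (n ^ q) ^ r)     ≡⟨ x*[y*z]≡y*[x*z] (2 ^ r) (n ^ ρ) ((n ^ q) ^ r) ⟨
  2 ^ r * (n ^ ρ * (n ^ q) ^ r)     ≡⟨ cong (2 ^ r *_) (w^n≡ n) ⟨
  2 ^ r * n ^ n                     ∎
  where
  open ≤-Reasoning
  n = r + w
  q = n / r
  ρ = n % r
  n≡ρ+qr : n ≡ ρ + q * r
  n≡ρ+qr = m≡m%n+[m/n]*n n r
  w^n≡ : ∀ x → x ^ n ≡ x ^ ρ * (x ^ q) ^ r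
  w^n≡ x = trans (cong (x ^_) n≡ρ+qr) (trans (^-distribˡ-+-* x ρ (q * r)) (cong (x ^ ρ *_) (sym (^-*-assoc x q r))))
  n≤2qr : n ≤ q * r + q * r
  n≤2qr with q | n≡ρ+qr
  ... | zero  | n≡ρ = contradiction (≤-trans (m≤m+n r w) (≤-reflexive (trans n≡ρ (+-identityʳ ρ)))) (<⇒≱ (m%n<n n r))
  ... | suc q′ | n≡ = ≤-trans (≤-reflexive n≡) (+-monoˡ-≤ (suc q′ * r) (≤-trans (<⇒≤ (m%n<n n r)) (m≤m+n r (q′ * r))))
  3w^q≤2n^q : 3 * w ^ q ≤ 2 * n ^ q
  3w^q≤2n^q = *-cancelʳ-≤ _ _ n (begin
    3 * w ^ q * n                ≡⟨ regroup₁ (w ^ q) n ⟩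
    w ^ q * (n + n + n)          ≤⟨ *-monoʳ-≤ (w ^ q) (+-monoˡ-≤ n (+-monoˡ-≤ n n≤2qr)) ⟩
    w ^ q * (q * r + q * r + n + n) ≡⟨ regroup₂ (w ^ q) (q * r) n ⟩
    2 * (w ^ q * (n + q * r))    ≤⟨ *-monoʳ-≤ 2 (bernoulli-reciprocal r w q) ⟩
    2 * (n ^ q * n)              ≡⟨ *-assoc 2 (n ^ q) n ⟨
    2 * n ^ q * n                ∎)
    where
    regroup₁ : ∀ a n → 3 * a * n ≡ a * (n + n + n)
    regroup₁ = solve-∀
    regroup₂ : ∀ a b n → a * (b + b + n + n) ≡ 2 * (a * (n + b))
    regroup₂ = solve-∀

[6/5]^r≤[3/2]^[r-1] : ∀ K → 6 ^ (2 + K) * 2 ^ (1 + K) ≤ 5 ^ (2 + K) * 3 ^ (1 + K)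
[6/5]^r≤[3/2]^[r-1] zero    = m≤m+n 72 3
[6/5]^r≤[3/2]^[r-1] (suc K) = begin
  6 * 6 ^ (2 + K) * (2 * 2 ^ (1 + K))   ≡⟨ regroup₁ (6 ^ (2 + K)) (2 ^ (1 + K)) ⟩
  12 * (6 ^ (2 + K) * 2 ^ (1 + K))      ≤⟨ *-mono-≤ (m≤m+n 12 3) ([6/5]^r≤[3/2]^[r-1] K) ⟩
  15 * (5 ^ (2 + K) * 3 ^ (1 + K))      ≡⟨ regroup₂ (5 ^ (2 + K)) (3 ^ (1 + K)) ⟩
  5 * 5 ^ (2 + K) * (3 * 3 ^ (1 + K))   ∎
  where
  open ≤-Reasoning
  regroup₁ : ∀ a b → 6 * a * (2 * b) ≡ 12 * (a * b)
  regroup₁ = solve-∀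
  regroup₂ : ∀ a b → 15 * (a * b) ≡ 5 * a * (3 * b)
  regroup₂ = solve-∀

[1-r/n]^[n[r-1]]≤[5/6]^[r²] : ∀ K w → let r = 2 + K; n = r + w in
  6 ^ (r * r) * (w ^ n) ^ (1 + K) ≤ 5 ^ (r * r) * (n ^ n) ^ (1 + K)
[1-r/n]^[n[r-1]]≤[5/6]^[r²] K w = *-cancelʳ-≤ _ _ T₃ {{m^n≢0 (3 ^ r) L {{m^n≢0 3 r}}}} (begin
  S₆ * (w ^ n) ^ L * T₃       ≡⟨ x*y*z≡x*z*y S₆ _ T₃ ⟩
  S₆ * T₃ * (w ^ n) ^ L       ≡⟨ *-assoc S₆ T₃ _ ⟩
  S₆ * (T₃ * (w ^ n) ^ L)     ≤⟨ *-monoʳ-≤ S₆ (^-mono-*-≤ {3 ^ r} {w ^ n} {2 ^ r} {n ^ n} L ([1-r/n]^n≤[2/3]^r r w z<s)) ⟩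
  S₆ * (T₂ * (n ^ n) ^ L)     ≡⟨ *-assoc S₆ T₂ _ ⟨
  S₆ * T₂ * (n ^ n) ^ L       ≤⟨ *-monoˡ-≤ ((n ^ n) ^ L) sixth-powers ⟩
  S₅ * T₃ * (n ^ n) ^ L       ≡⟨ x*y*z≡x*z*y S₅ T₃ _ ⟩
  S₅ * (n ^ n) ^ L * T₃       ∎)
  where
  open ≤-Reasoning
  r = 2 + K
  L = 1 + K
  n = r + w
  S₅ = 5 ^ (r * r)
  S₆ = 6 ^ (r * r)
  T₂ = (2 ^ r) ^ L
  T₃ = (3 ^ r) ^ L
  sixth-powers : S₆ * T₂ ≤ S₅ * T₃
  sixth-powers = subst₂ _≤_ (cong₂ _*_ (^-*-assoc 6 r r) (^-comm 2 L r)) (cong₂ _*_ (^-*-assoc 5 r r) (^-comm 3 L r))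
                   (^-mono-*-≤ {6 ^ r} {2 ^ L} {5 ^ r} {3 ^ L} r ([6/5]^r≤[3/2]^[r-1] K))

-- Hypergraphs given by edge lists

Covers : ∀ {n} → List (Subset n) → Subset n → Set
Covers E X = All (λ e → Nonempty (X ∩ e)) E

CoverNumber≥ : ∀ {n} → List (Subset n) → ℕ → Set
CoverNumber≥ E k = ∀ X → Covers E X → k ≤ ∣ X ∣

Uniform : ∀ {n} → ℕ → List (Subset n) → Set
Uniform r E = All (λ e → ∣ e ∣ ≡ r) E

indicator : Side → ℕ
indicator inside  = 1
indicator outside = 0

∣∷∣ : ∀ {n} b (p : Subset n) → ∣ b ∷ p ∣ ≡ indicator b + ∣ p ∣
∣∷∣ inside  p = refl
∣∷∣ outside p = refl

∣removeAt∣ : ∀ {n} (p : Subset (suc n)) i → indicator (lookup p i) + ∣ removeAt p i ∣ ≡ ∣ p ∣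
∣removeAt∣ (b ∷ p)         zero    = sym (∣∷∣ b p)
∣removeAt∣ (b ∷ p@(_ ∷ _)) (suc i) = begin
  indicator (lookup p i) + ∣ b ∷ removeAt p i ∣         ≡⟨ cong (indicator (lookup p i) +_) (∣∷∣ b (removeAt p i)) ⟩
  indicator (lookup p i) + (indicator b + ∣ removeAt p i ∣) ≡⟨ x+[y+z]≡y+[x+z] (indicator (lookup p i)) (indicator b) _ ⟩
  indicator b + (indicator (lookup p i) + ∣ removeAt p i ∣) ≡⟨ cong (indicator b +_) (∣removeAt∣ p i) ⟩
  indicator b + ∣ p ∣                                      ≡⟨ ∣∷∣ b p ⟨
  ∣ b ∷ p ∣                                                ∎
  where
  open ≡-Reasoning

∣insertAt∣ : ∀ {n} (p : Subset n) i b → ∣ insertAt p i b ∣ ≡ indicator b + ∣ p ∣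
∣insertAt∣ p i b = begin
  ∣ insertAt p i b ∣                                                      ≡⟨ ∣removeAt∣ (insertAt p i b) i ⟨
  indicator (lookup (insertAt p i b) i) + ∣ removeAt (insertAt p i b) i ∣ ≡⟨ cong₂ (λ x q → indicator x + ∣ q ∣) (insertAt-lookup p i b) (removeAt-insertAt p i b) ⟩
  indicator b + ∣ p ∣                                                     ∎
  where open ≡-Reasoning

∑-indicator : ∀ {n} (p : Subset n) → sum (λ i → indicator (lookup p i)) ≡ ∣ p ∣
∑-indicator []            = refl
∑-indicator (inside  ∷ p) = cong suc (∑-indicator p)
∑-indicator (outside ∷ p) = ∑-indicator p

∣p∣>0⇒Nonempty : ∀ {n} (p : Subset n) → 0 < ∣ p ∣ → Nonempty p
∣p∣>0⇒Nonempty (inside  ∷ p) _   = zero , here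
∣p∣>0⇒Nonempty (outside ∷ p) ∣p∣>0 with ∣p∣>0⇒Nonempty p ∣p∣>0
... | i , i∈p = suc i , there i∈p

i∈insertAt : ∀ {n} (p : Subset n) i → i ∈ insertAt p i inside
i∈insertAt p i = lookup⇒[]= i _ (insertAt-lookup p i inside)

punchIn-∈-insertAt : ∀ {n} {p : Subset n} i b {j} → j ∈ p → punchIn i j ∈ insertAt p i b
punchIn-∈-insertAt {p = p} i b {j} j∈p = lookup⇒[]= _ _ (trans (insertAt-punchIn p i b j) ([]=⇒lookup j∈p))

punchIn-∈ : ∀ {n} (p : Subset (suc n)) i {j} → j ∈ removeAt p i → punchIn i j ∈ p
punchIn-∈ p i j∈p = subst (punchIn i _ ∈_) (insertAt-removeAt p i) (punchIn-∈-insertAt i (lookup p i) j∈p)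

degree : ∀ {n} → List (Subset n) → Fin n → ℕ
degree []      i = 0
degree (e ∷ E) i = indicator (lookup e i) + degree E i

∑-degree : ∀ {n r} (E : List (Subset n)) → Uniform r E → sum (degree E) ≡ length E * r
∑-degree {n} []      []       = sum-replicate-zero n
∑-degree {r = r} (e ∷ E) (∣e∣≡r ∷ uniform) = begin
  sum (λ i → indicator (lookup e i) + degree E i)       ≡⟨ ∑-distrib-+ (λ i → indicator (lookup e i)) (degree E) ⟩
  sum (λ i → indicator (lookup e i)) + sum (degree E)   ≡⟨ cong₂ _+_ (trans (∑-indicator e) ∣e∣≡r) (∑-degree E uniform) ⟩
  r + length E * r                                      ∎
  where open ≡-Reasoning

∃-above-average : ∀ {n} (f : Fin (suc n) → ℕ) → ∃ λ i → sum f ≤ suc n * f i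
∃-above-average {zero}  f = zero , ≤-refl
∃-above-average {suc n} f with ∃-above-average (λ i → f (suc i))
... | i , ∑≤ with f zero ≤? f (suc i)
...   | yes f₀≤fᵢ = suc i , +-mono-≤ f₀≤fᵢ ∑≤
...   | no  f₀≰fᵢ = zero , +-monoʳ-≤ (f zero) (≤-trans ∑≤ (*-monoʳ-≤ (suc n) (<⇒≤ (≰⇒> f₀≰fᵢ))))

removeVertex : ∀ {n} → List (Subset (suc n)) → Fin (suc n) → List (Subset n)
removeVertex []      i = []
removeVertex (e ∷ E) i with lookup e i
... | inside  = removeVertex E i
... | outside = removeAt e i ∷ removeVertex E i

removeVertex-∷-inside : ∀ {n} e (E : List (Subset (suc n))) {i} → lookup e i ≡ inside → removeVertex (e ∷ E) i ≡ removeVertex E i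
removeVertex-∷-inside e E eᵢ rewrite eᵢ = refl

length-removeVertex : ∀ {n} (E : List (Subset (suc n))) i → length (removeVertex E i) + degree E i ≡ length E
length-removeVertex []      i = refl
length-removeVertex (e ∷ E) i with lookup e i
... | inside  = trans (+-suc _ _) (cong suc (length-removeVertex E i))
... | outside = cong suc (length-removeVertex E i)

removeVertex-uniform : ∀ {n r} (E : List (Subset (suc n))) i → Uniform r E → Uniform r (removeVertex E i)
removeVertex-uniform []      i []                  = []
removeVertex-uniform (e ∷ E) i (∣e∣≡r ∷ uniform) with lookup e i in eᵢ
... | inside  = removeVertex-uniform E i uniform
... | outside = trans (trans (sym (cong (λ b → indicator b + ∣ removeAt e i ∣) eᵢ)) (∣removeAt∣ e i)) ∣e∣≡r
                ∷ removeVertex-uniform E i uniform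

removeVertex-covers : ∀ {n} (E : List (Subset (suc n))) i {X} →
                      Covers (removeVertex E i) X → Covers E (insertAt X i inside)
removeVertex-covers []      i []     = []
removeVertex-covers (e ∷ E) i {X} covers with lookup e i in eᵢ
... | inside = (i , x∈p∩q⁺ (i∈insertAt X i , lookup⇒[]= i e eᵢ)) ∷ removeVertex-covers E i covers
removeVertex-covers (e ∷ E) i {X} ((j , j∈X∩e) ∷ covers) | outside with x∈p∩q⁻ X (removeAt e i) j∈X∩e
... | j∈X , j∈e = (punchIn i j , x∈p∩q⁺ (punchIn-∈-insertAt i inside j∈X , punchIn-∈ e i j∈e))
                  ∷ removeVertex-covers E i covers

removeVertex-coverNumber : ∀ {n k} (E : List (Subset (suc n))) i →
                           CoverNumber≥ E (suc k) → CoverNumber≥ (removeVertex E i) k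
removeVertex-coverNumber E i τ≥ X covers =
  s≤s⁻¹ (≤-trans (τ≥ (insertAt X i inside) (removeVertex-covers E i covers)) (≤-reflexive (∣insertAt∣ X i inside)))

coverNumber≤length : ∀ {n r k} (E : List (Subset n)) → Uniform (suc r) E → CoverNumber≥ E k → k ≤ length E
coverNumber≤length         {k = zero}  E        uniform  τ≥ = z≤n
coverNumber≤length {n}     {k = suc k} []       uniform  τ≥ = contradiction (≤-trans (τ≥ ∅ []) (≤-reflexive (∣⊥∣≡0 n))) n≮0
coverNumber≤length {zero}  {k = suc k} ([] ∷ E) (() ∷ _) τ≥
coverNumber≤length {suc n} {k = suc k} (e ∷ E)  uniform@(∣e∣≡1+r ∷ _) τ≥
  with ∣p∣>0⇒Nonempty e (≤-trans (s≤s z≤n) (≤-reflexive (sym ∣e∣≡1+r)))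
... | i , i∈e = s≤s (begin
  k                                  ≤⟨ coverNumber≤length (removeVertex (e ∷ E) i) (removeVertex-uniform (e ∷ E) i uniform) (removeVertex-coverNumber (e ∷ E) i τ≥) ⟩
  length (removeVertex (e ∷ E) i)    ≡⟨ cong length (removeVertex-∷-inside e E ([]=⇒lookup i∈e)) ⟩
  length (removeVertex E i)          ≤⟨ m≤m+n _ (degree E i) ⟩
  length (removeVertex E i) + degree E i ≡⟨ length-removeVertex E i ⟩
  length E                           ∎)
  where open ≤-Reasoning

deletion-bound : ∀ {m m′ d N r} → m′ + d ≡ m → m * r ≤ N * d → N * m′ ≤ m * (N ∸ r)
deletion-bound {m} {m′} {d} {N} {r} m′+d≡m mr≤Nd = begin
  N * m′                    ≡⟨ m+n∸n≡m (N * m′) (N * d) ⟨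
  N * m′ + N * d ∸ N * d    ≡⟨ cong (_∸ N * d) (trans (sym (*-distribˡ-+ N m′ d)) (cong (N *_) m′+d≡m)) ⟩
  N * m ∸ N * d             ≤⟨ ∸-monoʳ-≤ (N * m) mr≤Nd ⟩
  N * m ∸ m * r             ≡⟨ cong (_∸ m * r) (*-comm N m) ⟩
  m * N ∸ m * r             ≡⟨ *-distribˡ-∸ m N r ⟨
  m * (N ∸ r)               ∎
  where open ≤-Reasoning

coverNumber-falling-bound : ∀ {n r k} j (E : List (Subset n)) → Uniform (suc r) E → CoverNumber≥ E k → j < k →
                            (k ∸ j) * falling n j ≤ length E * falling (n ∸ suc r) j
coverNumber-falling-bound zero E uniform τ≥ _ = *-monoˡ-≤ 1 (coverNumber≤length E uniform τ≥)
coverNumber-falling-bound {zero} {k = k} (suc j) E _ _ _ = ≤-trans (≤-reflexive (*-zeroʳ (k ∸ suc j))) z≤n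
coverNumber-falling-bound {suc n} {r} {suc k} (suc j) E uniform τ≥ (s≤s j<k) with ∃-above-average (degree E)
... | i , ∑≤ = begin
  (k ∸ j) * (suc n * falling n j)          ≡⟨ x*[y*z]≡y*[x*z] (k ∸ j) (suc n) (falling n j) ⟩
  suc n * ((k ∸ j) * falling n j)          ≤⟨ *-monoʳ-≤ (suc n) E∖i-bound ⟩
  suc n * (length E∖i * falling (n ∸ suc r) j) ≡⟨ *-assoc (suc n) (length E∖i) _ ⟨
  suc n * length E∖i * falling (n ∸ suc r) j  ≤⟨ *-monoˡ-≤ _ (deletion-bound (length-removeVertex E i) degree-bound) ⟩
  length E * (n ∸ r) * falling (n ∸ suc r) j  ≡⟨ *-assoc (length E) (n ∸ r) _ ⟩
  length E * ((n ∸ r) * falling (n ∸ suc r) j) ≡⟨ cong (λ x → length E * ((n ∸ r) * falling x j)) (pred[m∸n]≡m∸[1+n] n r) ⟨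
  length E * ((n ∸ r) * falling (pred (n ∸ r)) j) ∎
  where
  open ≤-Reasoning
  E∖i = removeVertex E i
  E∖i-bound : (k ∸ j) * falling n j ≤ length E∖i * falling (n ∸ suc r) j
  E∖i-bound = coverNumber-falling-bound j E∖i (removeVertex-uniform E i uniform) (removeVertex-coverNumber E i τ≥) j<k
  degree-bound : length E * suc r ≤ suc n * degree E i
  degree-bound = subst (_≤ suc n * degree E i) (∑-degree E uniform) ∑≤

-- The lower bound on the number of edges

shift-balance : ∀ L q ρ v → suc v ≡ ρ + q * (suc L + suc L) → ρ < suc L + suc L →
  (L + L + suc v) * suc v < 5 * suc L * suc q * (ρ + q * suc L)
shift-balance L q ρ v x≡ρ+2qr ρ<2r = begin-strict
  (L + L + suc v) * suc v   <⟨ *-monoˡ-< (suc v) (+-monoˡ-< (suc v) (+-mono-< (n<1+n L) (n<1+n L))) ⟩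
  (r + r + suc v) * suc v   ≡⟨ cong (λ x → (r + r + x) * x) x≡ρ+2qr ⟩
  (r + r + x) * x           ≤⟨ +-cancelʳ-≤ (ρ * ρ) _ _ (≤-trans (+-monoʳ-≤ ((r + r + x) * x) ρ²≤) (≤-reflexive (identity r q ρ))) ⟩
  5 * r * suc q * (ρ + q * r) ∎
  where
  open ≤-Reasoning
  r = suc L
  x = ρ + q * (r + r)
  rest = q * r * (q * r) + q * r * r + q * r * ρ + r * ρ
  ρ²≤ : ρ * ρ ≤ (r + r) * ρ + rest
  ρ²≤ = ≤-trans (*-monoˡ-≤ ρ (<⇒≤ ρ<2r)) (m≤m+n ((r + r) * ρ) rest)
  identity : ∀ r q ρ → (r + r + (ρ + q * (r + r))) * (ρ + q * (r + r)) + ((r + r) * ρ + (q * r * (q * r) + q * r * r + q * r * ρ + r * ρ))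
                       ≡ 5 * r * suc q * (ρ + q * r) + ρ * ρ
  identity = solve-∀

-- s = ⌊x / 2r⌋ for x = suc v: the quotient of rising factorials is at most x / (x ∸ s r) by
-- rising-shift, and x ∸ s r = ρ + s r is large enough for shift-balance.
∃-shift : ∀ L v → suc v ≤ L * L →
  ∃ λ s → s ≤ L × (L + L + suc v) * rising (suc v + suc L) s < 5 * suc L * suc s * rising (suc v) s
∃-shift L v x≤L² = q , q≤L , *-cancelʳ-< (x ∸ q * r) (n * rising (x + r) q) (5 * r * suc q * rising x q) (begin-strict
  n * rising (x + r) q * (x ∸ q * r)     ≡⟨ *-assoc n (rising (x + r) q) _ ⟩
  n * (rising (x + r) q * (x ∸ q * r))   ≤⟨ *-monoʳ-≤ n (rising-shift q r (≤-refl {x})) ⟩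
  n * (rising x q * x)                   ≡⟨ x*[y*z]≡y*[x*z] n (rising x q) x ⟩
  rising x q * (n * x)                   <⟨ *-monoʳ-< (rising x q) {{>-nonZero (rising>0 q z<s)}} n*x< ⟩
  rising x q * (5 * r * suc q * (x ∸ q * r)) ≡⟨ x*[y*z]≡y*x*z (rising x q) (5 * r * suc q) (x ∸ q * r) ⟩
  5 * r * suc q * rising x q * (x ∸ q * r) ∎)
  where
  open ≤-Reasoning
  r = suc L
  x = suc v
  n = L + L + x
  q = x / (r + r)
  ρ = x % (r + r)
  x≡ρ+2qr : x ≡ ρ + q * (r + r)
  x≡ρ+2qr = m≡m%n+[m/n]*n x (r + r)
  x∸qr≡ρ+qr : x ∸ q * r ≡ ρ + q * r
  x∸qr≡ρ+qr = trans (cong (_∸ q * r) (trans x≡ρ+2qr (split ρ q r))) (m+n∸n≡m (ρ + q * r) (q * r))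
    where
    split : ∀ ρ q r → ρ + q * (r + r) ≡ ρ + q * r + q * r
    split = solve-∀
  n*x< : n * x < 5 * r * suc q * (x ∸ q * r)
  n*x< = subst (λ w → n * x < 5 * r * suc q * w) (sym x∸qr≡ρ+qr) (shift-balance L q ρ v x≡ρ+2qr (m%n<n x (r + r)))
  q≤L : q ≤ L
  q≤L = s≤s⁻¹ (*-cancelʳ-< r q r (begin-strict
    q * r             ≤⟨ *-monoʳ-≤ q (m≤m+n r r) ⟩
    q * (r + r)       ≤⟨ m≤n+m (q * (r + r)) ρ ⟩
    ρ + q * (r + r)   ≡⟨ x≡ρ+2qr ⟨
    x                 ≤⟨ x≤L² ⟩
    L * L             <⟨ *-mono-< (n<1+n L) (n<1+n L) ⟩
    r * r             ∎))

falling-split-bound : ∀ {n m c L} j s → j + s ≡ L → j ≤ n →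
  suc s * falling n j ≤ m * falling (n ∸ suc L) j →
  n * falling (n ∸ j) s < c * suc s * falling (n ∸ suc L ∸ j) s →
  n * falling n L < m * (c * falling (n ∸ suc L) L)
falling-split-bound {n} {m} {c} j s refl j≤n first-j last-s = begin-strict
  n * falling n (j + s)                  ≡⟨ cong (n *_) (falling-+ n j s) ⟩
  n * (falling n j * falling (n ∸ j) s)  ≡⟨ x*[y*z]≡y*[x*z] n (falling n j) _ ⟩
  falling n j * (n * falling (n ∸ j) s)  <⟨ *-monoʳ-< (falling n j) {{>-nonZero (falling>0 j≤n)}} last-s ⟩
  falling n j * (c * suc s * G)          ≡⟨ regroup₁ (falling n j) c (suc s) G ⟩
  c * G * (suc s * falling n j)          ≤⟨ *-monoʳ-≤ (c * G) first-j ⟩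
  c * G * (m * falling N j)              ≡⟨ regroup₂ c G m (falling N j) ⟩
  m * (c * (falling N j * G))            ≡⟨ cong (λ z → m * (c * z)) (falling-+ N j s) ⟨
  m * (c * falling N (j + s))            ∎
  where
  open ≤-Reasoning
  N = n ∸ suc (j + s)
  G = falling (N ∸ j) s
  regroup₁ : ∀ f c s g → f * (c * s * g) ≡ c * g * (s * f)
  regroup₁ = solve-∀
  regroup₂ : ∀ c g m f → c * g * (m * f) ≡ m * (c * (f * g))
  regroup₂ = solve-∀

2L+x<[1+L]²⇒x≤L² : ∀ L v → L + L + suc v < suc L * suc L → suc v ≤ L * L
2L+x<[1+L]²⇒x≤L² L v n<r² = +-cancelˡ-≤ (L + L) (suc v) (L * L) (s≤s⁻¹ (subst (L + L + suc v <_) (square L) n<r²))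
  where
  square : ∀ L → suc L * suc L ≡ suc (L + L + L * L)
  square = solve-∀

edges>falling-bound : ∀ {n} L v → L + L + suc v ≡ n → (E : List (Subset n)) → Uniform (suc L) E → CoverNumber≥ E (suc L) →
  n < suc L * suc L → n * falling n L < length E * (5 * suc L * falling (n ∸ suc L) L)
edges>falling-bound L v refl E uniform τ≥ n<r² with ∃-shift L v (2L+x<[1+L]²⇒x≤L² L v n<r²)
... | s , s≤L , rising-ratio< with m≤n⇒∃[o]m+o≡n s≤L
... | j , refl = falling-split-bound {m = length E} {c = 5 * suc (s + j)} j s (+-comm j s) j≤n first-j last-s
  where
  n = (s + j) + (s + j) + suc v
  j≤n : j ≤ n
  j≤n = ≤-trans (m≤n+m j s) (≤-trans (m≤m+n (s + j) (s + j)) (m≤m+n _ (suc v)))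
  first-j : suc s * falling n j ≤ length E * falling (n ∸ suc (s + j)) j
  first-j = subst (λ a → a * falling n j ≤ length E * falling (n ∸ suc (s + j)) j) (m+n∸n≡m (suc s) j)
              (coverNumber-falling-bound j E uniform τ≥ (s≤s (m≤n+m j s)))
  n∸j : n ∸ j ≡ v + suc (s + j) + s
  n∸j = trans (cong (_∸ j) (split₁ s j v)) (m+n∸m≡n j _)
    where
    split₁ : ∀ s j v → s + j + (s + j) + suc v ≡ j + (v + suc (s + j) + s)
    split₁ = solve-∀
  n∸r∸j : n ∸ suc (s + j) ∸ j ≡ v + s
  n∸r∸j = begin
    n ∸ suc (s + j) ∸ j                           ≡⟨ cong (λ t → t ∸ suc (s + j) ∸ j) (split₂ s j v) ⟩
    suc (s + j) + (j + (v + s)) ∸ suc (s + j) ∸ j ≡⟨ cong (_∸ j) (m+n∸m≡n (suc (s + j)) (j + (v + s))) ⟩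
    j + (v + s) ∸ j                               ≡⟨ m+n∸m≡n j (v + s) ⟩
    v + s                                         ∎
    where
    open ≡-Reasoning
    split₂ : ∀ s j v → s + j + (s + j) + suc v ≡ suc (s + j) + (j + (v + s))
    split₂ = solve-∀
  last-s : n * falling (n ∸ j) s < 5 * suc (s + j) * suc s * falling (n ∸ suc (s + j) ∸ j) s
  last-s = subst₂ (λ a b → n * a < 5 * suc (s + j) * suc s * b)
             (sym (trans (cong (λ t → falling t s) n∸j) (falling≡rising (v + suc (s + j)) s)))
             (sym (trans (cong (λ t → falling t s) n∸r∸j) (falling≡rising v s)))
             rising-ratio<

edges>binomial-bound : ∀ {n} L (E : List (Subset n)) → Uniform (suc L) E → CoverNumber≥ E (suc L) →
  2 * suc L ∸ 1 ≤ n → n < suc L * suc L → n * (n C L) < length E * (5 * suc L * ((n ∸ suc L) C L))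
edges>binomial-bound {n} L E uniform τ≥ 2r-1≤n n<r² with m≤n⇒∃[o]m+o≡n 2r-1≤n
... | v , 2r-1+v≡n = *-cancelʳ-< (L !) _ _ (subst₂ _<_
  (trans (cong (n *_) (sym (C*!≡falling n L))) (sym (*-assoc n _ _)))
  (trans (cong (λ f → length E * (5 * suc L * f)) (sym (C*!≡falling (n ∸ suc L) L))) (regroup (length E) (5 * suc L) _ (L !)))
  (edges>falling-bound L v (trans (rearrange L v) 2r-1+v≡n) E uniform τ≥ n<r²))
  where
  rearrange : ∀ L v → L + L + suc v ≡ L + suc (L + 0) + v
  rearrange = solve-∀
  regroup : ∀ m c b f → m * (c * (b * f)) ≡ m * (c * b) * f
  regroup = solve-∀

-- The exponential lower bound

falling-power-bound : ∀ K n → 2 + K ≤ n →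
  6 ^ ((2 + K) * (2 + K)) * falling (n ∸ (2 + K)) (1 + K) ^ n ≤ 5 ^ ((2 + K) * (2 + K)) * falling n (1 + K) ^ n
falling-power-bound K n r≤n = *-cancelʳ-≤ _ _ A {{m^n≢0 (n ^ L) n {{m^n≢0 n L {{>-nonZero (≤-trans z<s r≤n)}}}}}} (begin
  S₆ * F′ ^ n * A               ≡⟨ *-assoc S₆ (F′ ^ n) A ⟩
  S₆ * (F′ ^ n * A)             ≤⟨ *-monoʳ-≤ S₆ (^-mono-*-≤ {F′} {n ^ L} {F} {w ^ L} n one-factor) ⟩
  S₆ * (F ^ n * (w ^ L) ^ n)    ≡⟨ x*[y*z]≡y*[x*z] S₆ (F ^ n) _ ⟩
  F ^ n * (S₆ * (w ^ L) ^ n)    ≡⟨ cong (λ z → F ^ n * (S₆ * z)) (^-comm w L n) ⟩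
  F ^ n * (S₆ * (w ^ n) ^ L)    ≤⟨ *-monoʳ-≤ (F ^ n) (subst (λ m → S₆ * (w ^ m) ^ L ≤ S₅ * (m ^ m) ^ L) r+w≡n ([1-r/n]^[n[r-1]]≤[5/6]^[r²] K w)) ⟩
  F ^ n * (S₅ * (n ^ n) ^ L)    ≡⟨ cong (λ z → F ^ n * (S₅ * z)) (^-comm n n L) ⟩
  F ^ n * (S₅ * A)              ≡⟨ x*[y*z]≡y*[x*z] (F ^ n) S₅ A ⟩
  S₅ * (F ^ n * A)              ≡⟨ *-assoc S₅ (F ^ n) A ⟨
  S₅ * F ^ n * A                ∎)
  where
  open ≤-Reasoning
  r = 2 + K
  L = 1 + K
  w = n ∸ r
  F = falling n L
  F′ = falling w L
  S₅ = 5 ^ (r * r)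
  S₆ = 6 ^ (r * r)
  A = (n ^ L) ^ n
  r+w≡n : r + w ≡ n
  r+w≡n = m+[n∸m]≡n r≤n
  one-factor : F′ * n ^ L ≤ F * w ^ L
  one-factor = falling-ratio-≤ {n} {r} {w} {n} L (m∸n≤m n r) (≤-reflexive (*-comm w n))

binomial-power-bound : ∀ K n → 2 + K ≤ n →
  6 ^ ((2 + K) * (2 + K)) * ((n ∸ (2 + K)) C (1 + K)) ^ n ≤ 5 ^ ((2 + K) * (2 + K)) * (n C (1 + K)) ^ n
binomial-power-bound K n r≤n = *-cancelʳ-≤ _ _ (((1 + K) !) ^ n) {{m^n≢0 ((1 + K) !) n {{(1 + K) !≢0}}}} (begin
  S₆ * Cₙ₋ᵣ ^ n * L! ^ n     ≡⟨ *-assoc S₆ (Cₙ₋ᵣ ^ n) (L! ^ n) ⟩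
  S₆ * (Cₙ₋ᵣ ^ n * L! ^ n)   ≡⟨ cong (S₆ *_) (trans (sym (^-distribʳ-* Cₙ₋ᵣ L! n)) (cong (_^ n) (C*!≡falling (n ∸ r) L))) ⟩
  S₆ * falling (n ∸ r) L ^ n ≤⟨ falling-power-bound K n r≤n ⟩
  S₅ * falling n L ^ n     ≡⟨ cong (S₅ *_) (trans (cong (_^ n) (sym (C*!≡falling n L))) (^-distribʳ-* Cₙ L! n)) ⟩
  S₅ * (Cₙ ^ n * L! ^ n)    ≡⟨ *-assoc S₅ (Cₙ ^ n) (L! ^ n) ⟨
  S₅ * Cₙ ^ n * L! ^ n      ∎)
  where
  open ≤-Reasoning
  r = 2 + K
  L = 1 + K
  L! = L !
  Cₙ = n C L
  Cₙ₋ᵣ = (n ∸ r) C L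
  S₅ = 5 ^ (r * r)
  S₆ = 6 ^ (r * r)

-- Rationals as fractions of naturals

infix 4 _≃_/_

_≃_/_ : ℚ → ℕ → (b : ℕ) → .{{NonZero b}} → Set
p ≃ a / b = toℚᵘ p ≃ᵘ (ℤ.+ a) /ᵘ b

ratio-≃ : ∀ a b .{{_ : NonZero b}} → ratio a b ≃ a / b
ratio-≃ a (suc b) = toℚᵘ-fromℚᵘ (mkℚᵘ (ℤ.+ a) b)

0ℚ-≃ : 0ℚ ≃ 0 / 1
0ℚ-≃ = ≃-refl

1ℚ-≃ : 1ℚ ≃ 1 / 1
1ℚ-≃ = ≃-refl

*-≃ : ∀ {p q a b c d} .{{_ : NonZero b}} .{{_ : NonZero d}} →
      p ≃ a / b → q ≃ c / d → (p *ℚ q ≃ a * c / b * d) {{m*n≢0 b d}}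
*-≃ {p} {q} {a} {suc b} {c} {suc d} p≃ q≃ =
  ≃-trans (toℚᵘ-homo-* p q) (≃-trans (*-cong p≃ q≃) (≃-reflexive (cong (λ z → mkℚᵘ z (d + b * suc d)) (sym (ℤₚ.pos-* a c)))))

^-≃ : ∀ {p a b} .{{_ : NonZero b}} k → p ≃ a / b → (p ^ℚ k ≃ a ^ k / b ^ k) {{m^n≢0 b k}}
^-≃ zero    p≃ = 1ℚ-≃
^-≃ {b = b} (suc k) p≃ = *-≃ {{_}} {{m^n≢0 b k}} p≃ (^-≃ k p≃)

≤-≃ : ∀ {p q a b c d} .{{_ : NonZero b}} .{{_ : NonZero d}} →
      p ≃ a / b → q ≃ c / d → a * d ≤ c * b → p ≤ℚ q
≤-≃ {a = a} {suc b} {c} {suc d} p≃ q≃ ad≤cb = toℚᵘ-cancel-≤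
  (≤-respˡ-≃ (≃-sym p≃) (≤-respʳ-≃ (≃-sym q≃) (*≤* (subst₂ ℤ._≤_ (ℤₚ.pos-* a (suc d)) (ℤₚ.pos-* c (suc b)) (+≤+ ad≤cb)))))

<-≃ : ∀ {p q a b c d} .{{_ : NonZero b}} .{{_ : NonZero d}} →
      p ≃ a / b → q ≃ c / d → a * d < c * b → p <ℚ q
<-≃ {a = a} {suc b} {c} {suc d} p≃ q≃ ad<cb = toℚᵘ-cancel-<
  (<-respˡ-≃ (≃-sym p≃) (<-respʳ-≃ (≃-sym q≃) (*<* (subst₂ ℤ._<_ (ℤₚ.pos-* a (suc d)) (ℤₚ.pos-* c (suc b)) (+<+ ad<cb)))))

denominator≢0 : ∀ L n → 2 * suc L ∸ 1 ≤ n → NonZero (5 * suc L * ((n ∸ suc L) C L))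
denominator≢0 L n 2r-1≤n = m*n≢0 (5 * suc L) _ {{_}} {{>-nonZero (C>0 L≤n∸r)}}
  where
  L≤n∸r : L ≤ n ∸ suc L
  L≤n∸r = m+n≤o⇒m≤o∸n L (subst (_≤ n) (cong (λ t → L + suc t) (+-identityʳ L)) 2r-1≤n)

numEdges>bound : (r n : ℕ) → 2 * r ∸ 1 ≤ n → n < r * r → (H : UniformHypergraph n r) → CoverNumberAtLeast H r →
  ratio (n * (n C (r ∸ 1))) (5 * r * ((n ∸ r) C (r ∸ 1))) <ℚ ratio (numEdges H) 1
numEdges>bound zero    n _ () H τ≥
numEdges>bound (suc L) n 2r-1≤n n<r² H τ≥ = <-≃ {{D≢0}} (ratio-≃ _ _ {{D≢0}}) (ratio-≃ (numEdges H) 1)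
  (subst (_< numEdges H * (5 * suc L * ((n ∸ suc L) C L))) (sym (*-identityʳ _)) (edges>binomial-bound L (edges H) (uniform H) τ≥ 2r-1≤n n<r²))
  where
  D≢0 = denominator≢0 L n 2r-1≤n

bound≥exponential : (r n : ℕ) → 2 * r ∸ 1 ≤ n → n < r * r →
  ((ratio 1 5 *ℚ ratio n r) ^ℚ n) *ℚ (ratio 6 5 ^ℚ (r * r))
    ≤ℚ (ratio (n * (n C (r ∸ 1))) (5 * r * ((n ∸ r) C (r ∸ 1)))) ^ℚ n
bound≥exponential zero          n       _ ()
bound≥exponential 1             (suc n) _ (s≤s ())
bound≥exponential (suc (suc K)) n 2r-1≤n _ =
  ≤-≃ {{m*n≢0 _ _ {{m^n≢0 (5 * r) n}} {{m^n≢0 5 (r * r)}}}} {{m^n≢0 D n {{D≢0}}}}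
    (*-≃ {{m^n≢0 (5 * r) n}} {{m^n≢0 5 (r * r)}} (^-≃ n (*-≃ (ratio-≃ 1 5) (ratio-≃ n r))) (^-≃ (r * r) (ratio-≃ 6 5)))
    (^-≃ {{D≢0}} n (ratio-≃ _ _ {{D≢0}}))
    cross-multiplied
  where
  r = suc (suc K)
  L = suc K
  R = r * r
  Cₙ = n C L
  Cₙ₋ᵣ = (n ∸ r) C L
  D = 5 * r * Cₙ₋ᵣ
  D≢0 = denominator≢0 L n 2r-1≤n
  r≤n : r ≤ n
  r≤n = m+n≤o⇒n≤o L (subst (_≤ n) (cong (L +_) (+-identityʳ r)) 2r-1≤n)
  cross-multiplied : (1 * n) ^ n * 6 ^ R * D ^ n ≤ (n * Cₙ) ^ n * ((5 * r) ^ n * 5 ^ R)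
  cross-multiplied = begin
    (1 * n) ^ n * 6 ^ R * D ^ n                 ≡⟨ cong₂ (λ a b → a ^ n * 6 ^ R * b) (*-identityˡ n) (^-distribʳ-* (5 * r) Cₙ₋ᵣ n) ⟩
    n ^ n * 6 ^ R * ((5 * r) ^ n * Cₙ₋ᵣ ^ n)    ≡⟨ *-interchange (n ^ n) (6 ^ R) ((5 * r) ^ n) (Cₙ₋ᵣ ^ n) ⟩
    n ^ n * (5 * r) ^ n * (6 ^ R * Cₙ₋ᵣ ^ n)    ≤⟨ *-monoʳ-≤ (n ^ n * (5 * r) ^ n) (binomial-power-bound K n r≤n) ⟩
    n ^ n * (5 * r) ^ n * (5 ^ R * Cₙ ^ n)      ≡⟨ regroup (n ^ n) ((5 * r) ^ n) (5 ^ R) (Cₙ ^ n) ⟩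
    n ^ n * Cₙ ^ n * ((5 * r) ^ n * 5 ^ R)      ≡⟨ cong (_* ((5 * r) ^ n * 5 ^ R)) (^-distribʳ-* n Cₙ n) ⟨
    (n * Cₙ) ^ n * ((5 * r) ^ n * 5 ^ R)        ∎
    where
    open ≤-Reasoning
    regroup : ∀ a b c d → a * b * (c * d) ≡ a * d * (b * c)
    regroup = solve-∀

proposition4p1 : ((r n : ℕ) → (2 * r) ∸ 1 ≤ n → n < r * r →
      (H : UniformHypergraph n r) → CoverNumberAtLeast H r →
      ratio (n * (n C (r ∸ 1))) (5 * r * ((n ∸ r) C (r ∸ 1))) <ℚ ratio (numEdges H) 1)
    ×
    Σ ℚ (λ b → Σ ℚ (λ c′ → 1ℚ <ℚ b × 0ℚ <ℚ c′ ×
      ((r n : ℕ) → (2 * r) ∸ 1 ≤ n → n < r * r →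
        ((c′ *ℚ ratio n r) ^ℚ n) *ℚ (b ^ℚ (r * r))
          ≤ℚ (ratio (n * (n C (r ∸ 1))) (5 * r * ((n ∸ r) C (r ∸ 1)))) ^ℚ n)))
proposition4p1 = numEdges>bound , ratio 6 5 , ratio 1 5 , 1<6/5 , 0<1/5 , bound≥exponential
  where
  1<6/5 : 1ℚ <ℚ ratio 6 5
  1<6/5 = <-≃ 1ℚ-≃ (ratio-≃ 6 5) (n<1+n 5)
  0<1/5 : 0ℚ <ℚ ratio 1 5
  0<1/5 = <-≃ 0ℚ-≃ (ratio-≃ 1 5) z<s
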